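{- Let $\mathbf{p}=(p_1,\dots,p_n)$ be a target probability distribution on $\{1,\dots,n\}$, let $\Delta$ be an error measure on pairs of probability distributions on $\{1,\dots,n\}$, and let $k\ge 1$ be an integer. Suppose $\hat T$ is an entropy-optimal DDG tree using $k$ bits of precision whose output distribution $\hat{\mathbf{p}}$ is a $\Delta$-closest approximation to $\mathbf{p}$, i.e. $\Delta(\mathbf{p},\hat{\mathbf{p}})\le\Delta(\mathbf{p},\mathbf{q})$ for every output distribution $\mathbf{q}$ of an entropy-optimal DDG tree using $k$ bits of precision. Then for every sampler $\widetilde T$ (entropy-optimal or not) that always halts after consuming at most $k$ random bits from the source, its output distribution $\widetilde{\mathbf{p}}$ satisfies $\Delta(\mathbf{p},\hat{\mathbf{p}})\le\Delta(\mathbf{p},\widetilde{\mathbf{p}})$.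
   Context: Random bit model: a source supplies independent fair bits. A sampler is described by its discrete distribution generating (DDG) tree $T=(S,r,n,c,\delta)$: $S\subseteq\mathbb{N}$ is a set of nodes, $r\in S$ the root, $n\ge1$ the number of outcomes, $c:S\to\{1,\dots,n\}\cup\{\mathsf{branch}\}$ labels each node as a branch node or a leaf labelled by an outcome, and $\delta:S\times\{0,1\}\to S$ is the transition function. Sampling starts at $r$; at a branch node a fresh fair bit $b$ is drawn and the sampler moves to $\delta(\text{node},b)$; on reaching a leaf labelled $i$ it outputs $i$. The map $\delta$ may contain back-edges, so a finite $S$ may encode an infinite tree. The output distribution of $T$ is $(p_1,\dots,p_n)$ where $p_i$ is the probability that the process halts with output $i$. The number of consumed bits is the number of bits drawn before halting. $T$ is entropy-optimal if its expected number of consumed bits is minimal among all DDG trees with the same output distribution. $T$ uses $k$ bits of precision if $S$ is finite and the longest simple path through $\delta$ from $r$ to any leaf has exactly $k$ edges. -}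

module Defs where

open import Data.Nat as ℕ using (ℕ; zero; suc)
open import Data.Integer using (+_)
open import Data.Fin using (Fin; zero; suc)
open import Data.Fin.Properties using () renaming (_≟_ to _≟ᶠ_)
open import Data.Bool using (Bool; true; false; if_then_else_)
open import Data.List using (List; []; _∷_; length; concatMap)
open import Data.List.Membership.Propositional using (_∈_)
open import Data.List.Relation.Unary.Unique.Propositional using (Unique)
open import Data.Rational using (ℚ; 0ℚ; 1ℚ; ½; _+_; _-_; _*_; _≤_; _<_; _/_)
open import Data.Product using (_×_; ∃; ∃-syntax)
open import Data.Unit using (⊤)
open import Data.Empty using (⊥)
open import Relation.Nullary using (does)
open import Relation.Binary.PropositionalEquality using (_≡_)

-- Nodes are natural numbers (S ⊆ ℕ); every n ∈ ℕ carries a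
-- label and transitions, nodes not reachable from the root are irrelevant.
-- Finite S (needed for "k bits of precision") is expressed in Precision.

data Label (n : ℕ) : Set where
  leaf   : Fin n → Label n
  branch : Label n

record DDG (n : ℕ) : Set where
  field
    root  : ℕ
    label : ℕ → Label n
    δ     : ℕ → Bool → ℕ

open DDG public

data Result (n : ℕ) : Set where
  halted  : Fin n → Result n
  pending : Result n

run : ∀ {n} → DDG n → ℕ → List Bool → Result n
run T v bs with label T v
... | leaf i = halted i
... | branch with bs
...   | []       = pending
...   | b ∷ bs'  = run T (δ T v b) bs'

bitStrings : ℕ → List (List Bool)
bitStrings zero    = [] ∷ []
bitStrings (suc t) = concatMap (λ bs → (false ∷ bs) ∷ (true ∷ bs) ∷ []) (bitStrings t)

count : {A : Set} → (A → Bool) → List A → ℕ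
count f []       = 0
count f (x ∷ xs) = if f x then suc (count f xs) else count f xs

haltedAt : ∀ {n} → Fin n → Result n → Bool
haltedAt i (halted j) = does (i ≟ᶠ j)
haltedAt i pending    = false

isPending : ∀ {n} → Result n → Bool
isPending (halted _) = false
isPending pending    = true

fromℕ : ℕ → ℚ
fromℕ m = (+ m) / 1

half^ : ℕ → ℚ
half^ zero    = 1ℚ
half^ (suc t) = ½ * half^ t

haltProb : ∀ {n} → DDG n → ℕ → Fin n → ℚ
haltProb T t i = fromℕ (count (λ bs → haltedAt i (run T (root T) bs)) (bitStrings t)) * half^ t

notHaltedProb : ∀ {n} → DDG n → ℕ → ℚ
notHaltedProb T t = fromℕ (count (λ bs → isPending (run T (root T) bs)) (bitStrings t)) * half^ t

-- partial sums  Σ_{t<N} Pr[more than t bits consumed]; their supremum is the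
-- expected number of consumed bits.
partialE : ∀ {n} → DDG n → ℕ → ℚ
partialE T zero    = 0ℚ
partialE T (suc N) = partialE T N + notHaltedProb T N

sumFin : ∀ {n} → (Fin n → ℚ) → ℚ
sumFin {zero}  f = 0ℚ
sumFin {suc n} f = f zero + sumFin (λ i → f (suc i))

-- q is the supremum (= limit, the sequences here are monotone) of a
IsSup : (ℕ → ℚ) → ℚ → Set
IsSup a q = (∀ t → a t ≤ q) × (∀ ε → 0ℚ < ε → ∃[ t ] (q - ε < a t))

OutputDist : ∀ {n} → DDG n → (Fin n → ℚ) → Set
OutputDist T q = (∀ i → IsSup (λ t → haltProb T t i) (q i)) × (sumFin q ≡ 1ℚ)

-- E[bits consumed by T] ≤ E[bits consumed by T'] (values in [0,∞])
ExpBitsLe : ∀ {n} → DDG n → DDG n → Set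
ExpBitsLe T T' = ∀ N ε → 0ℚ < ε → ∃[ M ] (partialE T N < partialE T' M + ε)

EntropyOptimal : ∀ {n} → DDG n → Set
EntropyOptimal {n} T =
  (T' : DDG n) (q : Fin n → ℚ) → OutputDist T q → OutputDist T' q → ExpBitsLe T T'

trace : ∀ {n} → DDG n → ℕ → List Bool → List ℕ
trace T v []       = v ∷ []
trace T v (b ∷ bs) = v ∷ trace T (δ T v b) bs

endNode : ∀ {n} → DDG n → ℕ → List Bool → ℕ
endNode T v []       = v
endNode T v (b ∷ bs) = endNode T (δ T v b) bs

IsLeaf : ∀ {n} → Label n → Set
IsLeaf (leaf _) = ⊤
IsLeaf branch   = ⊥

SimplePathToLeaf : ∀ {n} → DDG n → List Bool → Set
SimplePathToLeaf T bs = Unique (trace T (root T) bs) × IsLeaf (label T (endNode T (root T) bs))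

-- T uses k bits of precision: S finite (a finite δ-closed node set containing
-- the root) and the longest simple path from r to a leaf has exactly k edges
Precision : ∀ {n} → DDG n → ℕ → Set
Precision T k =
  (∃[ S ] ((root T ∈ S) × (∀ v b → v ∈ S → δ T v b ∈ S))) ×
  (∃[ bs ] ((length bs ≡ k) × SimplePathToLeaf T bs)) ×
  (∀ bs → SimplePathToLeaf T bs → length bs ℕ.≤ k)

data IsHalted {n : ℕ} : Result n → Set where
  isHalted : ∀ i → IsHalted (halted i)

HaltsWithin : ∀ {n} → DDG n → ℕ → Set
HaltsWithin T k = ∀ bs → length bs ≡ k → IsHalted (run T (root T) bs)

module Submission where

-- A sampler T̃ that halts within k bits outputs i with probability c i / 2^k, where c i counts the
-- k-bit strings on which it outputs i, so ∑ c = 2^k. The Knuth–Yao tree of c has height at most k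
-- and outputs i on ⌊c i · 2^t / 2^k⌋ of the t-bit strings, for every t. No sampler of the same
-- distribution can do better, since it halts with i within t bits with probability at most c i / 2^k;
-- so any such sampler is still running after t bits with at least the same probability, which bounds
-- every partial sum of its expected number of bits from below: the Knuth–Yao sampler is entropy-optimal.
-- Compiled into a DDG whose nodes at depth k are all leaves, it uses exactly k bits of precision,
-- and the Δ-closest hypothesis applied to it gives the claim.

open import Defs
open import Data.Bool using (Bool; true; false; if_then_else_)
open import Data.Fin using (Fin; zero; suc)
import Data.Fin.Properties as FinP
import Data.Integer as ℤ
import Data.Integer.Properties as ℤP
open import Data.List using (List; []; _∷_; _++_; length; concat; concatMap; tabulate; replicate; upTo)
open import Data.List.Membership.Propositional using (_∈_)
open import Data.List.Membership.Propositional.Properties using (∈-upTo⁺)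
open import Data.List.Properties using (length-++; length-replicate)
open import Data.List.Relation.Unary.All as All using (All; []; _∷_)
import Data.List.Relation.Unary.All.Properties as AllP
open import Data.List.Relation.Unary.AllPairs using ([]; _∷_)
open import Data.List.Relation.Unary.Unique.Propositional using (Unique)
open import Data.Nat as ℕ using (ℕ; zero; suc; _+_; _*_; _^_; _∸_; _⊔_; _≤_; _<_; _<?_; z≤n; s≤s)
open import Data.Nat.Binary as ℕᵇ using (ℕᵇ; 2[1+_]; 1+[2_])
import Data.Nat.Binary.Properties as ℕᵇP
import Data.Nat.Coprimality as Coprime
import Data.Nat.Properties as ℕP
open import Algebra.Properties.Semiring.Sum ℕP.+-*-semiring
  using (sum-cong-≗; sum-replicate-zero; ∑-distrib-+; *-distribʳ-sum) renaming (sum to ∑)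
open import Data.Nat.DivMod using (_/_; _%_; m≡m%n+[m/n]*n; m*n/n≡m; /-monoˡ-≤)
open import Data.Nat.Solver using (module +-*-Solver)
open +-*-Solver using (solve; _:+_; _:*_; _:=_; con)
open import Data.Product using (_×_; _,_; proj₁; proj₂; ∃-syntax)
open import Data.Rational as ℚ using (ℚ; mkℚ; 0ℚ; 1ℚ; ½; NonNegative)
open import Data.Rational.Properties as ℚP using (*-assoc; *-comm; *-identityʳ)
open import Data.Sum using (_⊎_; inj₁; inj₂)
open import Function using (_∘_)
open import Relation.Nullary using (¬_; yes; no; does; contradiction)
open import Relation.Nullary.Decidable using (dec-true; dec-false)
open import Relation.Binary.PropositionalEquality

-- Dyadic rationals

fromℕ≡mkℚ : ∀ a → fromℕ a ≡ mkℚ (ℤ.+ a) 0 (Coprime.sym (Coprime.1-coprimeTo a))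
fromℕ≡mkℚ a = ℚP.normalize-coprime {a} {0} (Coprime.sym (Coprime.1-coprimeTo a))

fromℕ-+ : ∀ a b → fromℕ (a + b) ≡ fromℕ a ℚ.+ fromℕ b
fromℕ-+ a b rewrite fromℕ≡mkℚ a | fromℕ≡mkℚ b = ℚP./-cong {p₁ = ℤ.+ (a + b)} {q₁ = 1}
  (trans (ℤP.pos-+ a b) (sym (cong₂ ℤ._+_ (ℤP.*-identityʳ (ℤ.+ a)) (ℤP.*-identityʳ (ℤ.+ b))))) refl

fromℕ-* : ∀ a b → fromℕ (a * b) ≡ fromℕ a ℚ.* fromℕ b
fromℕ-* a b rewrite fromℕ≡mkℚ a | fromℕ≡mkℚ b = ℚP./-cong {p₁ = ℤ.+ (a * b)} {q₁ = 1} (ℤP.pos-* a b) refl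

fromℕ-mono-≤ : ∀ {a b} → a ≤ b → fromℕ a ℚ.≤ fromℕ b
fromℕ-mono-≤ {a} {b} a≤b rewrite fromℕ≡mkℚ a | fromℕ≡mkℚ b =
  ℚ.*≤* (subst₂ ℤ._≤_ (sym (ℤP.*-identityʳ (ℤ.+ a))) (sym (ℤP.*-identityʳ (ℤ.+ b))) (ℤ.+≤+ a≤b))

fromℕ-cancel-≤ : ∀ {a b} → fromℕ a ℚ.≤ fromℕ b → a ≤ b
fromℕ-cancel-≤ {a} {b} le rewrite fromℕ≡mkℚ a | fromℕ≡mkℚ b with le
... | ℚ.*≤* p with subst₂ ℤ._≤_ (ℤP.*-identityʳ (ℤ.+ a)) (ℤP.*-identityʳ (ℤ.+ b)) p
...   | ℤ.+≤+ a≤b = a≤b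

fromℕ-nonNeg : ∀ a → NonNegative (fromℕ a)
fromℕ-nonNeg a = ℚ.nonNegative (fromℕ-mono-≤ {0} {a} z≤n)

half^-nonNeg : ∀ t → NonNegative (half^ t)
half^-nonNeg zero = fromℕ-nonNeg 1
half^-nonNeg (suc t) = ℚP.nonNeg*nonNeg⇒nonNeg ½ (half^ t) {{half^-nonNeg t}}

half^-+ : ∀ s t → half^ (s + t) ≡ half^ s ℚ.* half^ t
half^-+ zero t = sym (ℚP.*-identityˡ (half^ t))
half^-+ (suc s) t = trans (cong (½ ℚ.*_) (half^-+ s t)) (sym (*-assoc ½ (half^ s) (half^ t)))

dyadic : ℕ → ℕ → ℚ
dyadic a t = fromℕ a ℚ.* half^ t

dyadic-2^ : ∀ t → dyadic (2 ^ t) t ≡ 1ℚ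
dyadic-2^ zero = refl
dyadic-2^ (suc t) = begin
  fromℕ (2 * 2 ^ t) ℚ.* (½ ℚ.* half^ t)            ≡⟨ cong (ℚ._* (½ ℚ.* half^ t)) (fromℕ-* 2 (2 ^ t)) ⟩
  fromℕ 2 ℚ.* fromℕ (2 ^ t) ℚ.* (½ ℚ.* half^ t)    ≡⟨ *-assoc (fromℕ 2) (fromℕ (2 ^ t)) (½ ℚ.* half^ t) ⟩
  fromℕ 2 ℚ.* (fromℕ (2 ^ t) ℚ.* (½ ℚ.* half^ t))  ≡⟨ cong (fromℕ 2 ℚ.*_) (swap (fromℕ (2 ^ t)) ½ (half^ t)) ⟩
  fromℕ 2 ℚ.* (½ ℚ.* dyadic (2 ^ t) t)             ≡⟨ sym (*-assoc (fromℕ 2) ½ (dyadic (2 ^ t) t)) ⟩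
  fromℕ 2 ℚ.* ½ ℚ.* dyadic (2 ^ t) t               ≡⟨ cong (fromℕ 2 ℚ.* ½ ℚ.*_) (dyadic-2^ t) ⟩
  1ℚ ∎
  where
  open ≡-Reasoning
  swap : ∀ x y z → x ℚ.* (y ℚ.* z) ≡ y ℚ.* (x ℚ.* z)
  swap x y z = trans (sym (*-assoc x y z)) (trans (cong (ℚ._* z) (*-comm x y)) (*-assoc y x z))

dyadic-+ : ∀ a b t → dyadic (a + b) t ≡ dyadic a t ℚ.+ dyadic b t
dyadic-+ a b t = trans (cong (ℚ._* half^ t) (fromℕ-+ a b)) (ℚP.*-distribʳ-+ (half^ t) (fromℕ a) (fromℕ b))

dyadic-mono-≤ : ∀ {a b} t → a ≤ b → dyadic a t ℚ.≤ dyadic b t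
dyadic-mono-≤ t a≤b = ℚP.*-monoʳ-≤-nonNeg (half^ t) {{half^-nonNeg t}} (fromℕ-mono-≤ a≤b)

dyadic-cancel-≤ : ∀ {a b} t → dyadic a t ℚ.≤ dyadic b t → a ≤ b
dyadic-cancel-≤ {a} {b} t le = fromℕ-cancel-≤ (subst₂ ℚ._≤_ (clear a) (clear b)
  (ℚP.*-monoʳ-≤-nonNeg (fromℕ (2 ^ t)) {{fromℕ-nonNeg (2 ^ t)}} le))
  where
  clear : ∀ x → dyadic x t ℚ.* fromℕ (2 ^ t) ≡ fromℕ x
  clear x = begin
    fromℕ x ℚ.* half^ t ℚ.* fromℕ (2 ^ t)    ≡⟨ *-assoc (fromℕ x) (half^ t) (fromℕ (2 ^ t)) ⟩
    fromℕ x ℚ.* (half^ t ℚ.* fromℕ (2 ^ t))  ≡⟨ cong (fromℕ x ℚ.*_) (trans (*-comm (half^ t) (fromℕ (2 ^ t))) (dyadic-2^ t)) ⟩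
    fromℕ x ℚ.* 1ℚ                           ≡⟨ *-identityʳ (fromℕ x) ⟩
    fromℕ x ∎
    where open ≡-Reasoning

dyadic-rescale : ∀ a s t → dyadic (a * 2 ^ s) (s + t) ≡ dyadic a t
dyadic-rescale a s t = begin
  fromℕ (a * 2 ^ s) ℚ.* half^ (s + t)                      ≡⟨ cong₂ ℚ._*_ (fromℕ-* a (2 ^ s)) (half^-+ s t) ⟩
  fromℕ a ℚ.* fromℕ (2 ^ s) ℚ.* (half^ s ℚ.* half^ t)      ≡⟨ *-assoc (fromℕ a) (fromℕ (2 ^ s)) (half^ s ℚ.* half^ t) ⟩
  fromℕ a ℚ.* (fromℕ (2 ^ s) ℚ.* (half^ s ℚ.* half^ t))    ≡⟨ cong (fromℕ a ℚ.*_) (sym (*-assoc (fromℕ (2 ^ s)) (half^ s) (half^ t))) ⟩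
  fromℕ a ℚ.* (dyadic (2 ^ s) s ℚ.* half^ t)               ≡⟨ cong (λ x → fromℕ a ℚ.* (x ℚ.* half^ t)) (dyadic-2^ s) ⟩
  fromℕ a ℚ.* (1ℚ ℚ.* half^ t)                             ≡⟨ cong (fromℕ a ℚ.*_) (ℚP.*-identityˡ (half^ t)) ⟩
  fromℕ a ℚ.* half^ t ∎
  where open ≡-Reasoning

dyadic-≤-cross : ∀ {a b} s t → a * 2 ^ s ≤ b * 2 ^ t → dyadic a t ℚ.≤ dyadic b s
dyadic-≤-cross {a} {b} s t le = subst₂ ℚ._≤_ (dyadic-rescale a s t)
  (trans (cong (dyadic (b * 2 ^ t)) (ℕP.+-comm s t)) (dyadic-rescale b t s)) (dyadic-mono-≤ (s + t) le)

dyadic-≤-cross⁻ : ∀ {a b} s t → dyadic a t ℚ.≤ dyadic b s → a * 2 ^ s ≤ b * 2 ^ t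
dyadic-≤-cross⁻ {a} {b} s t le = dyadic-cancel-≤ (s + t) (subst₂ ℚ._≤_ (sym (dyadic-rescale a s t))
  (trans (sym (dyadic-rescale b t s)) (cong (dyadic (b * 2 ^ t)) (ℕP.+-comm t s))) le)

-- Finite sums

∑-mono-≤ : ∀ {n} {a b : Fin n → ℕ} → (∀ i → a i ≤ b i) → ∑ a ≤ ∑ b
∑-mono-≤ {zero} le = z≤n
∑-mono-≤ {suc n} le = ℕP.+-mono-≤ (le zero) (∑-mono-≤ (le ∘ suc))

∑-zero : ∀ {n} {a : Fin n → ℕ} → (∀ i → a i ≡ 0) → ∑ a ≡ 0
∑-zero {n} a≗0 = trans (sum-cong-≗ a≗0) (sum-replicate-zero n)

∑-single : ∀ {n} (a : Fin n → ℕ) i → (∀ j → j ≢ i → a j ≡ 0) → ∑ a ≡ a i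
∑-single a zero others =
  trans (cong (a zero +_) (∑-zero (λ j → others (suc j) λ ()))) (ℕP.+-identityʳ (a zero))
∑-single a (suc i) others = trans (cong (_+ ∑ (a ∘ suc)) (others zero λ ()))
  (∑-single (a ∘ suc) i (λ j j≢i → others (suc j) (j≢i ∘ FinP.suc-injective)))

indicator : ∀ {n} → Fin n → Fin n → ℕ
indicator j i = if does (i FinP.≟ j) then 1 else 0

indicator-≡ : ∀ {n} (j : Fin n) → indicator j j ≡ 1
indicator-≡ j = cong (λ b → if b then 1 else 0) (dec-true (j FinP.≟ j) refl)

indicator-≢ : ∀ {n} {i j : Fin n} → i ≢ j → indicator j i ≡ 0
indicator-≢ {i = i} {j} i≢j = cong (λ b → if b then 1 else 0) (dec-false (i FinP.≟ j) i≢j)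

∑-indicator : ∀ {n} (j : Fin n) → ∑ (indicator j) ≡ 1
∑-indicator j = trans (∑-single (indicator j) j (λ i → indicator-≢)) (indicator-≡ j)

sumFin-mono-≤ : ∀ {n} {p q : Fin n → ℚ} → (∀ i → p i ℚ.≤ q i) → sumFin p ℚ.≤ sumFin q
sumFin-mono-≤ {zero} le = ℚP.≤-refl
sumFin-mono-≤ {suc n} le = ℚP.+-mono-≤ (le zero) (sumFin-mono-≤ (le ∘ suc))

sumFin-dyadic : ∀ {n} (a : Fin n → ℕ) t → sumFin (λ i → dyadic (a i) t) ≡ dyadic (∑ a) t
sumFin-dyadic {zero} a t = sym (ℚP.*-zeroˡ (half^ t))
sumFin-dyadic {suc n} a t = trans (cong (dyadic (a zero) t ℚ.+_) (sumFin-dyadic (a ∘ suc) t))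
  (sym (dyadic-+ (a zero) (∑ (a ∘ suc)) t))

+-≤-≡⇒≡ˡ : ∀ {x x′ y y′ : ℚ} → x ℚ.≤ x′ → y ℚ.≤ y′ → x ℚ.+ y ≡ x′ ℚ.+ y′ → x ≡ x′
+-≤-≡⇒≡ˡ {x} {x′} x≤x′ y≤y′ eq with x′ ℚP.≤? x
... | yes x′≤x = ℚP.≤-antisym x≤x′ x′≤x
... | no x′≰x = contradiction eq (ℚP.<⇒≢ (ℚP.+-mono-<-≤ (ℚP.≰⇒> x′≰x) y≤y′))

≤-sumFin-≡⇒≡ : ∀ {n} {p q : Fin n → ℚ} → (∀ i → p i ℚ.≤ q i) → sumFin p ≡ sumFin q → ∀ i → p i ≡ q i
≤-sumFin-≡⇒≡ {suc n} le eq zero = +-≤-≡⇒≡ˡ (le zero) (sumFin-mono-≤ (le ∘ suc)) eq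
≤-sumFin-≡⇒≡ {suc n} {p} {q} le eq (suc i) = ≤-sumFin-≡⇒≡ (le ∘ suc)
  (+-≤-≡⇒≡ˡ (sumFin-mono-≤ (le ∘ suc)) (le zero) (trans (ℚP.+-comm _ (p zero)) (trans eq (ℚP.+-comm (q zero) _)))) i

-- Counting bit strings

count-cong : ∀ {A : Set} {f g : A → Bool} → (∀ x → f x ≡ g x) → ∀ xs → count f xs ≡ count g xs
count-cong f≗g [] = refl
count-cong {f = f} {g} f≗g (x ∷ xs) rewrite f≗g x with g x
... | true = cong suc (count-cong f≗g xs)
... | false = count-cong f≗g xs

count-none : ∀ {A : Set} (f : A → Bool) {xs} → All (λ x → f x ≡ false) xs → count f xs ≡ 0
count-none f [] = refl
count-none f {x ∷ xs} (fx≡false ∷ rest) rewrite fx≡false = count-none f rest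

count-true : ∀ {A : Set} (xs : List A) → count (λ _ → true) xs ≡ length xs
count-true [] = refl
count-true (x ∷ xs) = cong suc (count-true xs)

count-bitStrings-suc : ∀ (f : List Bool → Bool) t → count f (bitStrings (suc t)) ≡
  count (λ bs → f (false ∷ bs)) (bitStrings t) + count (λ bs → f (true ∷ bs)) (bitStrings t)
count-bitStrings-suc f t = go (bitStrings t)
  where
  go : ∀ xs → count f (concatMap (λ bs → (false ∷ bs) ∷ (true ∷ bs) ∷ []) xs) ≡
         count (λ bs → f (false ∷ bs)) xs + count (λ bs → f (true ∷ bs)) xs
  go [] = refl
  go (x ∷ xs) with f (false ∷ x) | f (true ∷ x)
  ... | true  | true  = cong suc (trans (cong suc (go xs)) (sym (ℕP.+-suc _ _)))
  ... | true  | false = cong suc (go xs)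
  ... | false | true  = trans (cong suc (go xs)) (sym (ℕP.+-suc _ _))
  ... | false | false = go xs

length-bitStrings : ∀ t → length (bitStrings t) ≡ 2 ^ t
length-bitStrings zero = refl
length-bitStrings (suc t) = begin
  length (bitStrings (suc t))                                            ≡⟨ sym (count-true (bitStrings (suc t))) ⟩
  count (λ _ → true) (bitStrings (suc t))                                ≡⟨ count-bitStrings-suc (λ _ → true) t ⟩
  count (λ _ → true) (bitStrings t) + count (λ _ → true) (bitStrings t)  ≡⟨ cong (λ m → m + m) 2^t-strings ⟩
  2 ^ t + 2 ^ t                                                          ≡⟨ cong (2 ^ t +_) (sym (ℕP.+-identityʳ (2 ^ t))) ⟩
  2 ^ suc t ∎
  where
  open ≡-Reasoning
  2^t-strings : count (λ _ → true) (bitStrings t) ≡ 2 ^ t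
  2^t-strings = trans (count-true (bitStrings t)) (length-bitStrings t)

length-∈-bitStrings : ∀ t → All (λ bs → length bs ≡ t) (bitStrings t)
length-∈-bitStrings zero = refl ∷ []
length-∈-bitStrings (suc t) = go (length-∈-bitStrings t)
  where
  go : ∀ {xs} → All (λ bs → length bs ≡ t) xs →
       All (λ bs → length bs ≡ suc t) (concatMap (λ bs → (false ∷ bs) ∷ (true ∷ bs) ∷ []) xs)
  go [] = []
  go (eq ∷ eqs) = cong suc eq ∷ cong suc eq ∷ go eqs

-- Runs of a DDG

module _ {n} (T : DDG n) (v : ℕ) where

  run-leaf : ∀ {j} bs → label T v ≡ leaf j → run T v bs ≡ halted j
  run-leaf bs eq with label T v
  run-leaf bs refl | leaf _ = refl

  run-branch-[] : label T v ≡ branch → run T v [] ≡ pending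
  run-branch-[] eq with label T v
  run-branch-[] refl | branch = refl

  run-branch-∷ : ∀ b bs → label T v ≡ branch → run T v (b ∷ bs) ≡ run T (δ T v b) bs
  run-branch-∷ b bs eq with label T v
  run-branch-∷ b bs refl | branch = refl

trace-head : ∀ {n} (T : DDG n) {P : ℕ → Set} v bs → All P (trace T v bs) → P v
trace-head T v [] (p ∷ _) = p
trace-head T v (b ∷ bs) (p ∷ _) = p

if-suc : ∀ b m → (if b then suc m else m) ≡ (if b then 1 else 0) + m
if-suc true m = refl
if-suc false m = refl

pending+∑halted : ∀ {n} {A : Set} (g : A → Result n) xs →
  count (isPending ∘ g) xs + ∑ (λ i → count (haltedAt i ∘ g) xs) ≡ length xs
pending+∑halted {n} g [] = ∑-zero {n} (λ _ → refl)
pending+∑halted g (x ∷ xs) with g x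
... | pending = cong suc (pending+∑halted g xs)
... | halted j = begin
  P + ∑ (λ i → if does (i FinP.≟ j) then suc (H i) else H i)  ≡⟨ cong (P +_) (sum-cong-≗ (λ i → if-suc (does (i FinP.≟ j)) (H i))) ⟩
  P + ∑ (λ i → indicator j i + H i)                        ≡⟨ cong (P +_) (∑-distrib-+ (indicator j) H) ⟩
  P + (∑ (indicator j) + ∑ H)                              ≡⟨ cong (λ m → P + (m + ∑ H)) (∑-indicator j) ⟩
  P + suc (∑ H)                                            ≡⟨ ℕP.+-suc P (∑ H) ⟩
  suc (P + ∑ H)                                            ≡⟨ cong suc (pending+∑halted g xs) ⟩
  suc (length xs) ∎
  where
  open ≡-Reasoning
  P = count (isPending ∘ g) xs
  H = λ i → count (haltedAt i ∘ g) xs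

haltCount : ∀ {n} → DDG n → Fin n → ℕ → ℕ
haltCount T i t = count (λ bs → haltedAt i (run T (root T) bs)) (bitStrings t)

pendingCount : ∀ {n} → DDG n → ℕ → ℕ
pendingCount T t = count (λ bs → isPending (run T (root T) bs)) (bitStrings t)

pendingCount+∑haltCount : ∀ {n} (T : DDG n) t → pendingCount T t + ∑ (λ i → haltCount T i t) ≡ 2 ^ t
pendingCount+∑haltCount T t = trans (pending+∑halted (run T (root T)) (bitStrings t)) (length-bitStrings t)

pendingCount-anti : ∀ {n} (T T′ : DDG n) t →
                    (∀ i → haltCount T i t ≤ haltCount T′ i t) → pendingCount T′ t ≤ pendingCount T t
pendingCount-anti T T′ t halt≤ = ℕP.+-cancelʳ-≤ (∑ (λ i → haltCount T i t)) (pendingCount T′ t) (pendingCount T t) (begin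
  pendingCount T′ t + ∑ (λ i → haltCount T i t)    ≤⟨ ℕP.+-monoʳ-≤ (pendingCount T′ t) (∑-mono-≤ halt≤) ⟩
  pendingCount T′ t + ∑ (λ i → haltCount T′ i t)   ≡⟨ pendingCount+∑haltCount T′ t ⟩
  2 ^ t                                            ≡⟨ sym (pendingCount+∑haltCount T t) ⟩
  pendingCount T t + ∑ (λ i → haltCount T i t) ∎)
  where open ℕP.≤-Reasoning

pendingCount-mono⇒ExpBitsLe : ∀ {n} {T T′ : DDG n} → (∀ t → pendingCount T t ≤ pendingCount T′ t) → ExpBitsLe T T′
pendingCount-mono⇒ExpBitsLe {T = T} {T′} pending≤ N ε ε>0 = N , ℚP.≤-<-trans (partialE-mono N)
  (subst (ℚ._< partialE T′ N ℚ.+ ε) (ℚP.+-identityʳ (partialE T′ N)) (ℚP.+-monoʳ-< (partialE T′ N) ε>0))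
  where
  partialE-mono : ∀ N → partialE T N ℚ.≤ partialE T′ N
  partialE-mono zero = ℚP.≤-refl
  partialE-mono (suc N) = ℚP.+-mono-≤ (partialE-mono N) (dyadic-mono-≤ N (pending≤ N))

IsSup-attained : ∀ {a : ℕ → ℚ} {q} t₀ → (∀ t → a t ℚ.≤ q) → a t₀ ≡ q → IsSup a q
IsSup-attained {q = q} t₀ bound attained = bound , λ ε ε>0 → t₀ , subst (q ℚ.- ε ℚ.<_) (sym attained) (q-ε<q ε>0)
  where
  q-ε<q : ∀ {ε} → 0ℚ ℚ.< ε → q ℚ.- ε ℚ.< q
  q-ε<q ε>0 = subst (q ℚ.- _ ℚ.<_) (ℚP.+-identityʳ q) (ℚP.+-monoʳ-< q (ℚP.neg-antimono-< ε>0))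

module _ {n} (T : DDG n) {t} (halts : HaltsWithin T t) where

  pendingCount≡0 : pendingCount T t ≡ 0
  pendingCount≡0 = count-none _ (All.map (λ {bs} |bs|≡t → notPending (halts bs |bs|≡t)) (length-∈-bitStrings t))
    where
    notPending : ∀ {r : Result n} → IsHalted r → isPending r ≡ false
    notPending (isHalted _) = refl

  ∑haltCount≡2^ : ∑ (λ i → haltCount T i t) ≡ 2 ^ t
  ∑haltCount≡2^ = trans (cong (_+ ∑ (λ i → haltCount T i t)) (sym pendingCount≡0)) (pendingCount+∑haltCount T t)

  haltProb≡outputDist : ∀ {q} → OutputDist T q → ∀ i → haltProb T t i ≡ q i
  haltProb≡outputDist {q} (sup , ∑q≡1) = ≤-sumFin-≡⇒≡ (λ i → proj₁ (sup i) t) (begin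
    sumFin (haltProb T t)                   ≡⟨ sumFin-dyadic (λ i → haltCount T i t) t ⟩
    dyadic (∑ (λ i → haltCount T i t)) t    ≡⟨ cong (λ m → dyadic m t) ∑haltCount≡2^ ⟩
    dyadic (2 ^ t) t                        ≡⟨ dyadic-2^ t ⟩
    1ℚ                                      ≡⟨ sym ∑q≡1 ⟩
    sumFin q ∎)
    where open ≡-Reasoning

-- Finite binary trees

data Tree (n : ℕ) : Set where
  tip  : Fin n → Tree n
  fork : Tree n → Tree n → Tree n

height : ∀ {n} → Tree n → ℕ
height (tip _) = 0
height (fork l r) = suc (height l ⊔ height r)

child : ∀ {n} → Tree n → Bool → Tree n
child (tip j) _ = tip j
child (fork l r) false = l
child (fork l r) true = r

rootLabel : ∀ {n} → Tree n → Label n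
rootLabel (tip j) = leaf j
rootLabel (fork _ _) = branch

runTree : ∀ {n} → Tree n → List Bool → Result n
runTree (tip j) bs = halted j
runTree (fork l r) [] = pending
runTree (fork l r) (b ∷ bs) = runTree (child (fork l r) b) bs

treeCount : ∀ {n} → Tree n → Fin n → ℕ → ℕ
treeCount (tip j) i t = indicator j i * 2 ^ t
treeCount (fork l r) i zero = 0
treeCount (fork l r) i (suc t) = treeCount l i t + treeCount r i t

count-runTree : ∀ {n} (σ : Tree n) i t → count (λ bs → haltedAt i (runTree σ bs)) (bitStrings t) ≡ treeCount σ i t
count-runTree (tip j) i t = trans (count-const (does (i FinP.≟ j)) (bitStrings t)) (cong (indicator j i *_) (length-bitStrings t))
  where
  count-const : ∀ {A : Set} b (xs : List A) → count (λ _ → b) xs ≡ (if b then 1 else 0) * length xs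
  count-const true xs = trans (count-true xs) (sym (ℕP.*-identityˡ (length xs)))
  count-const false xs = count-none _ (All.universal (λ _ → refl) xs)
count-runTree (fork l r) i zero = refl
count-runTree (fork l r) i (suc t) =
  trans (count-bitStrings-suc _ t) (cong₂ _+_ (count-runTree l i t) (count-runTree r i t))

treeCount-*2^-≤ : ∀ {n} (σ : Tree n) i t u → treeCount σ i t * 2 ^ u ≤ treeCount σ i (t + u)
treeCount-*2^-≤ (tip j) i t u = ℕP.≤-reflexive (trans (ℕP.*-assoc (indicator j i) (2 ^ t) (2 ^ u))
  (cong (indicator j i *_) (sym (ℕP.^-distribˡ-+-* 2 t u))))
treeCount-*2^-≤ (fork l r) i zero u = z≤n
treeCount-*2^-≤ (fork l r) i (suc t) u =
  ℕP.≤-trans (ℕP.≤-reflexive (ℕP.*-distribʳ-+ (2 ^ u) (treeCount l i t) (treeCount r i t)))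
             (ℕP.+-mono-≤ (treeCount-*2^-≤ l i t u) (treeCount-*2^-≤ r i t u))

height-child : ∀ {n} (σ : Tree n) b → height (child σ b) ≤ ℕ.pred (height σ)
height-child (tip j) b = z≤n
height-child (fork l r) false = ℕP.m≤m⊔n (height l) (height r)
height-child (fork l r) true = ℕP.m≤n⊔m (height l) (height r)

runTree-halts : ∀ {n} (σ : Tree n) bs → height σ ≤ length bs → IsHalted (runTree σ bs)
runTree-halts (tip j) bs _ = isHalted j
runTree-halts (fork l r) (b ∷ bs) (s≤s h≤) = runTree-halts (child (fork l r) b) bs (ℕP.≤-trans (height-child (fork l r) b) h≤)

height≤0⇒IsLeaf : ∀ {n} (σ : Tree n) → height σ ≤ 0 → IsLeaf (rootLabel σ)
height≤0⇒IsLeaf (tip j) _ = _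

-- Compiling a tree into a DDG

push : ℕᵇ → Bool → ℕᵇ
push h false = 1+[2 h ]
push h true = 2[1+ h ]

size-push : ∀ h b → ℕᵇ.size (push h b) ≡ suc (ℕᵇ.size h)
size-push h false = refl
size-push h true = refl

toℕ+2≤2^suc-size : ∀ h → 2 + ℕᵇ.toℕ h ≤ 2 ^ suc (ℕᵇ.size h)
toℕ+2≤2^suc-size ℕᵇ.zero = ℕP.≤-refl
toℕ+2≤2^suc-size 2[1+ h ] = ℕP.≤-trans (ℕP.≤-reflexive (double (ℕᵇ.toℕ h))) (ℕP.*-monoʳ-≤ 2 (toℕ+2≤2^suc-size h))
  where
  double : ∀ t → 2 + 2 * suc t ≡ 2 * (2 + t)
  double t = solve 1 (λ t → con 2 :+ con 2 :* (con 1 :+ t) := con 2 :* (con 2 :+ t)) refl t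
toℕ+2≤2^suc-size 1+[2 h ] =
  ℕP.≤-trans (ℕP.n≤1+n _) (ℕP.≤-trans (ℕP.≤-reflexive (odd (ℕᵇ.toℕ h))) (ℕP.*-monoʳ-≤ 2 (toℕ+2≤2^suc-size h)))
  where
  odd : ∀ t → suc (2 + suc (2 * t)) ≡ 2 * (2 + t)
  odd t = solve 1 (λ t → con 4 :+ con 2 :* t := con 2 :* (con 2 :+ t)) refl t

descend : ∀ {n} → Tree n → ℕᵇ → Tree n
descend τ ℕᵇ.zero = τ
descend τ 1+[2 h ] = child (descend τ h) false
descend τ 2[1+ h ] = child (descend τ h) true

descend-push : ∀ {n} (τ : Tree n) h b → descend τ (push h b) ≡ child (descend τ h) b
descend-push τ h false = refl
descend-push τ h true = refl

pred-≤-∸suc : ∀ {m} a b → m ≤ a ∸ b → ℕ.pred m ≤ a ∸ suc b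
pred-≤-∸suc {m} a b m≤a∸b = subst (ℕ.pred m ≤_) (ℕP.pred[m∸n]≡m∸[1+n] a b) (ℕP.pred-mono-≤ m≤a∸b)

height-descend : ∀ {n} (τ : Tree n) h → height (descend τ h) ≤ height τ ∸ ℕᵇ.size h
height-descend τ ℕᵇ.zero = ℕP.≤-refl
height-descend τ 1+[2 h ] =
  ℕP.≤-trans (height-child (descend τ h) false) (pred-≤-∸suc (height τ) (ℕᵇ.size h) (height-descend τ h))
height-descend τ 2[1+ h ] =
  ℕP.≤-trans (height-child (descend τ h) true) (pred-≤-∸suc (height τ) (ℕᵇ.size h) (height-descend τ h))

-- A node is the number ℕᵇ.toℕ h of the bit string h read so far (ℕᵇ numerals are exactly bit strings,
-- the latest bit outermost); δ appends a bit below depth k and returns to the root from depth k.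
-- Nodes below a tip repeat its label, so all nodes at depth k are leaves and the all-false path is a
-- simple path with exactly k edges.
module Compile {n} (τ : Tree n) (k : ℕ) where

  level : ℕ → ℕ
  level v = ℕᵇ.size (ℕᵇ.fromℕ v)

  compile : DDG n
  compile = record
    { root  = 0
    ; label = λ v → rootLabel (descend τ (ℕᵇ.fromℕ v))
    ; δ     = λ v b → if does (level v <? k) then ℕᵇ.toℕ (push (ℕᵇ.fromℕ v) b) else 0
    }

  δ-below : ∀ v b → level v < k → δ compile v b ≡ ℕᵇ.toℕ (push (ℕᵇ.fromℕ v) b)
  δ-below v b lt = cong (λ c → if c then ℕᵇ.toℕ (push (ℕᵇ.fromℕ v) b) else 0) (dec-true (level v <? k) lt)

  δ-top : ∀ v b → ¬ level v < k → δ compile v b ≡ 0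
  δ-top v b ¬lt = cong (λ c → if c then ℕᵇ.toℕ (push (ℕᵇ.fromℕ v) b) else 0) (dec-false (level v <? k) ¬lt)

  level-toℕ : ∀ h → level (ℕᵇ.toℕ h) ≡ ℕᵇ.size h
  level-toℕ h = cong ℕᵇ.size (ℕᵇP.fromℕ-toℕ h)

  level-δ-below : ∀ v b → level v < k → level (δ compile v b) ≡ suc (level v)
  level-δ-below v b lt =
    trans (cong level (δ-below v b lt)) (trans (level-toℕ (push (ℕᵇ.fromℕ v) b)) (size-push (ℕᵇ.fromℕ v) b))

  level-δ : ∀ v b → δ compile v b ≡ 0 ⊎ (level v < k × level (δ compile v b) ≡ suc (level v))
  level-δ v b with level v <? k
  ... | yes lt = inj₂ (lt , level-δ-below v b lt)
  ... | no ¬lt = inj₁ (δ-top v b ¬lt)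

  label-toℕ : ∀ h → label compile (ℕᵇ.toℕ h) ≡ rootLabel (descend τ h)
  label-toℕ h = cong (rootLabel ∘ descend τ) (ℕᵇP.fromℕ-toℕ h)

  module _ (height≤k : height τ ≤ k) where

    size<k : ∀ h {l r} → descend τ h ≡ fork l r → ℕᵇ.size h < k
    size<k h eq = ℕP.<-≤-trans (ℕP.m∸n≢0⇒n<m ∸≢0) height≤k
      where
      ∸≢0 : height τ ∸ ℕᵇ.size h ≢ 0
      ∸≢0 ∸≡0 with subst (_≤ 0) (cong height eq) (subst (height (descend τ h) ≤_) ∸≡0 (height-descend τ h))
      ... | ()

    run-compile : ∀ h bs → run compile (ℕᵇ.toℕ h) bs ≡ runTree (descend τ h) bs
    run-compile h bs with descend τ h in eq | bs
    ... | tip j    | bs      = run-leaf compile (ℕᵇ.toℕ h) bs (trans (label-toℕ h) (cong rootLabel eq))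
    ... | fork l r | []      = run-branch-[] compile (ℕᵇ.toℕ h) (trans (label-toℕ h) (cong rootLabel eq))
    ... | fork l r | b ∷ bs′ = begin
      run compile (ℕᵇ.toℕ h) (b ∷ bs′)                           ≡⟨ run-branch-∷ compile (ℕᵇ.toℕ h) b bs′ isBranch ⟩
      run compile (δ compile (ℕᵇ.toℕ h) b) bs′                   ≡⟨ cong (λ w → run compile w bs′) (δ-below (ℕᵇ.toℕ h) b below) ⟩
      run compile (ℕᵇ.toℕ (push (ℕᵇ.fromℕ (ℕᵇ.toℕ h)) b)) bs′    ≡⟨ cong (λ x → run compile (ℕᵇ.toℕ (push x b)) bs′) (ℕᵇP.fromℕ-toℕ h) ⟩
      run compile (ℕᵇ.toℕ (push h b)) bs′                        ≡⟨ run-compile (push h b) bs′ ⟩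
      runTree (descend τ (push h b)) bs′                         ≡⟨ cong (λ σ → runTree σ bs′) (trans (descend-push τ h b) (cong (λ σ → child σ b) eq)) ⟩
      runTree (child (fork l r) b) bs′ ∎
      where
      open ≡-Reasoning
      isBranch : label compile (ℕᵇ.toℕ h) ≡ branch
      isBranch = trans (label-toℕ h) (cong rootLabel eq)
      below : level (ℕᵇ.toℕ h) < k
      below = subst (_< k) (sym (level-toℕ h)) (size<k h eq)

    haltCount-compile : ∀ i t → haltCount compile i t ≡ treeCount τ i t
    haltCount-compile i t =
      trans (count-cong (λ bs → cong (haltedAt i) (run-compile ℕᵇ.zero bs)) (bitStrings t)) (count-runTree τ i t)

    compile-halts : HaltsWithin compile k
    compile-halts bs |bs|≡k = subst IsHalted (sym (run-compile ℕᵇ.zero bs))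
      (runTree-halts τ bs (subst (height τ ≤_) (sym |bs|≡k) height≤k))

    k≤level⇒IsLeaf : ∀ v → k ≤ level v → IsLeaf (label compile v)
    k≤level⇒IsLeaf v k≤level = height≤0⇒IsLeaf (descend τ (ℕᵇ.fromℕ v))
      (ℕP.≤-trans (height-descend τ (ℕᵇ.fromℕ v)) (ℕP.≤-reflexive (ℕP.m≤n⇒m∸n≡0 (ℕP.≤-trans height≤k k≤level))))

    δ<2^suc-k : ∀ v b → δ compile v b < 2 ^ suc k
    δ<2^suc-k v b with level-δ v b
    ... | inj₁ δ≡0 = subst (_< 2 ^ suc k) (sym δ≡0) (ℕP.m^n>0 2 (suc k))
    ... | inj₂ (lt , _) = subst (_< 2 ^ suc k) (sym (δ-below v b lt)) (begin-strict
      ℕᵇ.toℕ h                 <⟨ ℕP.m<n+m (ℕᵇ.toℕ h) (s≤s z≤n) ⟩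
      2 + ℕᵇ.toℕ h             ≤⟨ toℕ+2≤2^suc-size h ⟩
      2 ^ suc (ℕᵇ.size h)      ≡⟨ cong (λ m → 2 ^ suc m) (size-push (ℕᵇ.fromℕ v) b) ⟩
      2 ^ suc (suc (level v))  ≤⟨ ℕP.^-monoʳ-≤ 2 (s≤s lt) ⟩
      2 ^ suc k ∎)
      where
      open ℕP.≤-Reasoning
      h = push (ℕᵇ.fromℕ v) b

    step-up : ∀ v b {m} → level v + suc m ≤ k →
              level (δ compile v b) ≡ suc (level v) × level (δ compile v b) + m ≤ k
    step-up v b {m} le = up , subst (_≤ k) (trans (ℕP.+-suc (level v) m) (cong (_+ m) (sym up))) le
      where
      up : level (δ compile v b) ≡ suc (level v)
      up = level-δ-below v b (ℕP.<-≤-trans (ℕP.m<m+n (level v) (s≤s z≤n)) le)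

    levels-above : ∀ v bs → level v + length bs ≤ k → All (λ w → level v ≤ level w) (trace compile v bs)
    levels-above v [] _ = ℕP.≤-refl ∷ []
    levels-above v (b ∷ bs) le with step-up v b le
    ... | up , le′ = ℕP.≤-refl ∷ All.map (λ lw → ℕP.≤-trans (ℕP.n≤1+n (level v)) (subst (_≤ _) up lw))
                                          (levels-above (δ compile v b) bs le′)

    trace-unique : ∀ v bs → level v + length bs ≤ k → Unique (trace compile v bs)
    trace-unique v [] _ = [] ∷ []
    trace-unique v (b ∷ bs) le with step-up v b le
    ... | up , le′ = All.map (λ lw v≡w → ℕP.<-irrefl (cong level v≡w) (ℕP.<-≤-trans below lw)) (levels-above (δ compile v b) bs le′)
                     ∷ trace-unique (δ compile v b) bs le′
      where
      below : level v < level (δ compile v b)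
      below = subst (level v <_) (sym up) (ℕP.n<1+n (level v))

    level-endNode : ∀ v bs → level v + length bs ≤ k → level (endNode compile v bs) ≡ level v + length bs
    level-endNode v [] _ = sym (ℕP.+-identityʳ (level v))
    level-endNode v (b ∷ bs) le with step-up v b le
    ... | up , le′ = trans (level-endNode (δ compile v b) bs le′)
                           (trans (cong (_+ length bs) up) (sym (ℕP.+-suc (level v) (length bs))))

    step-avoiding-root : ∀ v b bs → All (0 ≢_) (trace compile (δ compile v b) bs) →
                         level v < k × level (δ compile v b) ≡ suc (level v)
    step-avoiding-root v b bs avoid with level-δ v b
    ... | inj₁ δ≡0 = contradiction (sym δ≡0) (trace-head compile (δ compile v b) bs avoid)
    ... | inj₂ up = up

    avoiding-root-bounded : ∀ v b bs → All (0 ≢_) (trace compile (δ compile v b) bs) → level v + suc (length bs) ≤ k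
    avoiding-root-bounded v b bs avoid with step-avoiding-root v b bs avoid | bs | avoid
    ... | lt , _  | []       | _          = subst (_≤ k) (ℕP.+-comm 1 (level v)) lt
    ... | _  , up | b′ ∷ bs′ | _ ∷ avoid′ = subst (_≤ k) shift (avoiding-root-bounded (δ compile v b) b′ bs′ avoid′)
      where
      shift : level (δ compile v b) + suc (length bs′) ≡ level v + suc (suc (length bs′))
      shift = trans (cong (_+ suc (length bs′)) up) (sym (ℕP.+-suc (level v) (suc (length bs′))))

    nodes-finite : ∃[ S ] ((root compile ∈ S) × (∀ v b → v ∈ S → δ compile v b ∈ S))
    nodes-finite = upTo (2 ^ suc k) , ∈-upTo⁺ (ℕP.m^n>0 2 (suc k)) , λ v b _ → ∈-upTo⁺ (δ<2^suc-k v b)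

    longest-path : ∃[ bs ] (length bs ≡ k × SimplePathToLeaf compile bs)
    longest-path = replicate k false , |bs|≡k , trace-unique 0 bs |bs|≤k
                 , k≤level⇒IsLeaf (endNode compile 0 bs) (ℕP.≤-reflexive (sym (trans (level-endNode 0 bs |bs|≤k) |bs|≡k)))
      where
      bs = replicate k false
      |bs|≡k : length bs ≡ k
      |bs|≡k = length-replicate k
      |bs|≤k : level 0 + length bs ≤ k
      |bs|≤k = ℕP.≤-reflexive |bs|≡k

    simple⇒≤k : ∀ bs → SimplePathToLeaf compile bs → length bs ≤ k
    simple⇒≤k [] _ = z≤n
    simple⇒≤k (b ∷ bs) ((avoid ∷ _) , _) = avoiding-root-bounded 0 b bs avoid

    precision : Precision compile k
    precision = nodes-finite , longest-path , simple⇒≤k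

-- The Knuth–Yao tree

*-2^-split : ∀ a {s t} → s ≤ t → a * 2 ^ t ≡ a * 2 ^ (t ∸ s) * 2 ^ s
*-2^-split a {s} {t} s≤t = begin
  a * 2 ^ t                     ≡⟨ cong (λ e → a * 2 ^ e) (sym (ℕP.m∸n+n≡m s≤t)) ⟩
  a * 2 ^ (t ∸ s + s)         ≡⟨ cong (a *_) (ℕP.^-distribˡ-+-* 2 (t ∸ s) s) ⟩
  a * (2 ^ (t ∸ s) * 2 ^ s)   ≡⟨ sym (ℕP.*-assoc a (2 ^ (t ∸ s)) (2 ^ s)) ⟩
  a * 2 ^ (t ∸ s) * 2 ^ s ∎
  where open ≡-Reasoning

sole : ∀ {A : Set} (xs : List A) → length xs ≡ 1 → A
sole (x ∷ []) _ = x

sole-∷ : ∀ {A : Set} (xs : List A) (|xs|≡1 : length xs ≡ 1) → xs ≡ sole xs |xs|≡1 ∷ []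
sole-∷ (x ∷ []) _ = refl

module KnuthYao {n : ℕ} where

  forestCount : List (Tree n) → Fin n → ℕ → ℕ
  forestCount [] i t = 0
  forestCount (σ ∷ σs) i t = treeCount σ i t + forestCount σs i t

  forestCount-++ : ∀ σs ρs i t → forestCount (σs ++ ρs) i t ≡ forestCount σs i t + forestCount ρs i t
  forestCount-++ [] ρs i t = refl
  forestCount-++ (σ ∷ σs) ρs i t =
    trans (cong (treeCount σ i t +_) (forestCount-++ σs ρs i t)) (sym (ℕP.+-assoc (treeCount σ i t) _ _))

  leaves : (Fin n → ℕ) → List (Tree n)
  leaves m = concat (tabulate (λ j → replicate (m j) (tip j)))

  forestCount-concat : ∀ {p} (g : Fin p → List (Tree n)) i t →
                       forestCount (concat (tabulate g)) i t ≡ ∑ (λ j → forestCount (g j) i t)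
  forestCount-concat {zero} g i t = refl
  forestCount-concat {suc p} g i t =
    trans (forestCount-++ (g zero) _ i t) (cong (forestCount (g zero) i t +_) (forestCount-concat (g ∘ suc) i t))

  forestCount-replicate : ∀ a σ i t → forestCount (replicate a σ) i t ≡ a * treeCount σ i t
  forestCount-replicate zero σ i t = refl
  forestCount-replicate (suc a) σ i t = cong (treeCount σ i t +_) (forestCount-replicate a σ i t)

  forestCount-leaves : ∀ m i t → forestCount (leaves m) i t ≡ m i * 2 ^ t
  forestCount-leaves m i t = begin
    forestCount (leaves m) i t                           ≡⟨ forestCount-concat (λ j → replicate (m j) (tip j)) i t ⟩
    ∑ (λ j → forestCount (replicate (m j) (tip j)) i t)  ≡⟨ sum-cong-≗ (λ j → forestCount-replicate (m j) (tip j) i t) ⟩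
    ∑ (λ j → m j * (indicator j i * 2 ^ t))              ≡⟨ ∑-single _ i others ⟩
    m i * (indicator i i * 2 ^ t)                        ≡⟨ cong (λ x → m i * (x * 2 ^ t)) (indicator-≡ i) ⟩
    m i * (1 * 2 ^ t)                                    ≡⟨ cong (m i *_) (ℕP.*-identityˡ (2 ^ t)) ⟩
    m i * 2 ^ t ∎
    where
    open ≡-Reasoning
    others : ∀ j → j ≢ i → m j * (indicator j i * 2 ^ t) ≡ 0
    others j j≢i = trans (cong (λ x → m j * (x * 2 ^ t)) (indicator-≢ (≢-sym j≢i))) (ℕP.*-zeroʳ (m j))

  length-leaves : ∀ m → length (leaves m) ≡ ∑ m
  length-leaves m = go (λ j → replicate (m j) (tip j)) m (λ j → length-replicate (m j))
    where
    go : ∀ {p} (g : Fin p → List (Tree n)) (a : Fin p → ℕ) →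
         (∀ j → length (g j) ≡ a j) → length (concat (tabulate g)) ≡ ∑ a
    go {zero} g a eq = refl
    go {suc p} g a eq = trans (length-++ (g zero)) (cong₂ _+_ (eq zero) (go (g ∘ suc) (a ∘ suc) (eq ∘ suc)))

  halve-length : ∀ X {m} → suc (suc m) ≡ suc X + suc X → m ≡ X + X
  halve-length X eq = ℕP.suc-injective (trans (ℕP.suc-injective eq) (ℕP.+-suc X X))

  pairUp : List (Tree n) → List (Tree n)
  pairUp (l ∷ r ∷ σs) = fork l r ∷ pairUp σs
  pairUp _ = []

  length-pairUp : ∀ X σs → length σs ≡ X + X → length (pairUp σs) ≡ X
  length-pairUp zero [] _ = refl
  length-pairUp (suc X) (l ∷ r ∷ σs) eq = cong suc (length-pairUp X σs (halve-length X eq))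
  length-pairUp (suc X) (l ∷ []) eq = contradiction (trans (ℕP.suc-injective eq) (ℕP.+-suc X X)) λ ()

  forestCount-pairUp : ∀ X σs → length σs ≡ X + X → ∀ i t → forestCount (pairUp σs) i (suc t) ≡ forestCount σs i t
  forestCount-pairUp zero [] _ i t = refl
  forestCount-pairUp (suc X) (l ∷ r ∷ σs) eq i t =
    trans (cong (treeCount l i t + treeCount r i t +_) (forestCount-pairUp X σs (halve-length X eq) i t))
          (ℕP.+-assoc (treeCount l i t) _ _)
  forestCount-pairUp (suc X) (l ∷ []) eq = contradiction (trans (ℕP.suc-injective eq) (ℕP.+-suc X X)) λ ()

  even-difference : ∀ a b l → a + a + l ≡ b + b → ∃[ d ] (l ≡ d + d × a + d ≡ b)
  even-difference zero b l eq = b , eq , refl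
  even-difference (suc a) (suc b) l eq
    with even-difference a b l (halve-length b (trans (cong (λ x → suc (x + l)) (sym (ℕP.+-suc a a))) eq))
  ... | d , l≡d+d , a+d≡b = d , l≡d+d , cong suc a+d≡b

  halve : (Fin n → ℕ) → Fin n → ℕ
  halve m i = m i / 2

  layer : (Fin n → ℕ) → List (Tree n) → List (Tree n)
  layer m σs = leaves (λ i → m i % 2) ++ σs

  -- Bottom-up construction with f levels left to build: every odd count becomes a tip, these tips and
  -- the subtrees σs built so far are paired into the level above, and the counts are halved.
  forest : ℕ → (Fin n → ℕ) → List (Tree n) → List (Tree n)
  forest zero m σs = leaves m ++ σs
  forest (suc f) m σs = forest f (halve m) (pairUp (layer m σs))

  Balanced : ℕ → (Fin n → ℕ) → List (Tree n) → Set
  Balanced f m σs = ∑ m + length σs ≡ 2 ^ f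

  balanced-step : ∀ f m σs → Balanced (suc f) m σs →
                  ∃[ X ] (length (layer m σs) ≡ X + X × Balanced f (halve m) (pairUp (layer m σs)))
  balanced-step f m σs bal with even-difference (∑ (halve m)) (2 ^ f) (length (layer m σs)) items
    where
    A = ∑ (halve m)
    P = ∑ (λ i → m i % 2)
    ∑m : ∑ m ≡ P + A * 2
    ∑m = begin
      ∑ m                                  ≡⟨ sum-cong-≗ (λ i → m≡m%n+[m/n]*n (m i) 2) ⟩
      ∑ (λ i → m i % 2 + halve m i * 2)    ≡⟨ ∑-distrib-+ (λ i → m i % 2) (λ i → halve m i * 2) ⟩
      P + ∑ (λ i → halve m i * 2)          ≡⟨ cong (P +_) (sym (*-distribʳ-sum 2 (halve m))) ⟩
      P + A * 2 ∎
      where open ≡-Reasoning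
    items : A + A + length (layer m σs) ≡ 2 ^ f + 2 ^ f
    items = begin
      A + A + length (layer m σs)  ≡⟨ cong (A + A +_) (trans (length-++ (leaves (λ i → m i % 2))) (cong (_+ length σs) (length-leaves _))) ⟩
      A + A + (P + length σs)      ≡⟨ solve 3 (λ a p l → a :+ a :+ (p :+ l) := p :+ a :* con 2 :+ l) refl A P (length σs) ⟩
      P + A * 2 + length σs        ≡⟨ cong (_+ length σs) (sym ∑m) ⟩
      ∑ m + length σs              ≡⟨ bal ⟩
      2 ^ suc f                    ≡⟨ cong (2 ^ f +_) (ℕP.+-identityʳ (2 ^ f)) ⟩
      2 ^ f + 2 ^ f ∎
      where open ≡-Reasoning
  ... | X , |layer|≡X+X , bal′ = X , |layer|≡X+X , trans (cong (∑ (halve m) +_) (length-pairUp X (layer m σs) |layer|≡X+X)) bal′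

  length-forest : ∀ f m σs → Balanced f m σs → length (forest f m σs) ≡ 1
  length-forest zero m σs bal = trans (length-++ (leaves m)) (trans (cong (_+ length σs) (length-leaves m)) bal)
  length-forest (suc f) m σs bal with balanced-step f m σs bal
  ... | _ , _ , bal′ = length-forest f (halve m) (pairUp (layer m σs)) bal′

  forestCount-forest : ∀ f m σs → Balanced f m σs → ∀ i u →
                       forestCount (forest f m σs) i (f + u) ≡ m i * 2 ^ u + forestCount σs i u
  forestCount-forest zero m σs bal i u =
    trans (forestCount-++ (leaves m) σs i u) (cong (_+ forestCount σs i u) (forestCount-leaves m i u))
  forestCount-forest (suc f) m σs bal i u with balanced-step f m σs bal
  ... | X , |layer|≡X+X , bal′ = begin
    forestCount (forest f (halve m) ρs) i (suc f + u)   ≡⟨ cong (forestCount (forest f (halve m) ρs) i) (sym (ℕP.+-suc f u)) ⟩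
    forestCount (forest f (halve m) ρs) i (f + suc u)   ≡⟨ forestCount-forest f (halve m) ρs bal′ i (suc u) ⟩
    H * 2 ^ suc u + forestCount ρs i (suc u)            ≡⟨ cong (H * 2 ^ suc u +_) (forestCount-pairUp X (layer m σs) |layer|≡X+X i u) ⟩
    H * 2 ^ suc u + forestCount (layer m σs) i u        ≡⟨ cong (H * 2 ^ suc u +_) (forestCount-++ (leaves (λ j → m j % 2)) σs i u) ⟩
    H * 2 ^ suc u + (forestCount (leaves (λ j → m j % 2)) i u + F)
                                                        ≡⟨ cong (λ x → H * 2 ^ suc u + (x + F)) (forestCount-leaves (λ j → m j % 2) i u) ⟩
    H * 2 ^ suc u + (m i % 2 * 2 ^ u + F)               ≡⟨ solve 4 (λ h p x c → h :* (con 2 :* x) :+ (p :* x :+ c) := (p :+ h :* con 2) :* x :+ c)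
                                                                 refl H (m i % 2) (2 ^ u) F ⟩
    (m i % 2 + H * 2) * 2 ^ u + F                       ≡⟨ cong (λ x → x * 2 ^ u + F) (sym (m≡m%n+[m/n]*n (m i) 2)) ⟩
    m i * 2 ^ u + F ∎
    where
    open ≡-Reasoning
    ρs = pairUp (layer m σs)
    H = halve m i
    F = forestCount σs i u

  m≤forestCount-forest : ∀ f m σs → Balanced f m σs → ∀ i → m i ≤ forestCount (forest f m σs) i f
  m≤forestCount-forest f m σs bal i = subst₂ _≤_ (ℕP.*-identityʳ (m i))
    (trans (sym (forestCount-forest f m σs bal i 0)) (cong (forestCount (forest f m σs) i) (ℕP.+-identityʳ f)))
    (ℕP.m≤m+n (m i * 1) (forestCount σs i 0))

  *2≤⇒≤/2 : ∀ {a b} → a * 2 ≤ b → a ≤ b / 2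
  *2≤⇒≤/2 {a} {b} le = subst (_≤ b / 2) (m*n/n≡m a 2) (/-monoˡ-≤ 2 le)

  forestCount-forest-maximal : ∀ f m σs → Balanced f m σs → ∀ i {t C} → t ≤ f →
                         C * 2 ^ (f ∸ t) ≤ m i → C ≤ forestCount (forest f m σs) i t
  forestCount-forest-maximal zero m σs bal i {C = C} z≤n le =
    ℕP.≤-trans (subst (_≤ m i) (ℕP.*-identityʳ C) le) (m≤forestCount-forest zero m σs bal i)
  forestCount-forest-maximal (suc f) m σs bal i {C = C} t≤f le with ℕP.m≤n⇒m<n∨m≡n t≤f | balanced-step f m σs bal
  ... | inj₂ refl | _ = ℕP.≤-trans (subst (_≤ m i) (trans (cong (λ e → C * 2 ^ e) (ℕP.n∸n≡0 (suc f))) (ℕP.*-identityʳ C)) le)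
                          (m≤forestCount-forest (suc f) m σs bal i)
  ... | inj₁ (s≤s {m = t} t≤f′) | _ , _ , bal′ =
    forestCount-forest-maximal f (halve m) (pairUp (layer m σs)) bal′ i t≤f′ (*2≤⇒≤/2 (begin
      C * 2 ^ (f ∸ t) * 2      ≡⟨ ℕP.*-assoc C (2 ^ (f ∸ t)) 2 ⟩
      C * (2 ^ (f ∸ t) * 2)    ≡⟨ cong (C *_) (ℕP.*-comm (2 ^ (f ∸ t)) 2) ⟩
      C * 2 ^ suc (f ∸ t)      ≡⟨ cong (λ e → C * 2 ^ e) (sym (ℕP.+-∸-assoc 1 t≤f′)) ⟩
      C * 2 ^ (suc f ∸ t)      ≤⟨ le ⟩
      m i ∎))
    where open ℕP.≤-Reasoning

  height-leaves : ∀ m h → All (λ σ → height σ ≤ h) (leaves m)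
  height-leaves m h = AllP.concat⁺ (AllP.tabulate⁺ (λ j → AllP.replicate⁺ (m j) z≤n))

  height-pairUp : ∀ {h} σs → All (λ σ → height σ ≤ h) σs → All (λ σ → height σ ≤ suc h) (pairUp σs)
  height-pairUp [] _ = []
  height-pairUp (σ ∷ []) _ = []
  height-pairUp (l ∷ r ∷ σs) (hl ∷ hr ∷ hs) = s≤s (ℕP.⊔-lub hl hr) ∷ height-pairUp σs hs

  height-forest : ∀ f m σs {h} → All (λ σ → height σ ≤ h) σs → All (λ σ → height σ ≤ f + h) (forest f m σs)
  height-forest zero m σs hs = AllP.++⁺ (height-leaves m _) hs
  height-forest (suc f) m σs {h} hs = All.map (λ le → ℕP.≤-trans le (ℕP.≤-reflexive (ℕP.+-suc f h)))
    (height-forest f (halve m) (pairUp (layer m σs)) (height-pairUp (layer m σs) (AllP.++⁺ (height-leaves _ h) hs)))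

  module OfCounts (k : ℕ) (c : Fin n → ℕ) (∑c≡2^k : ∑ c ≡ 2 ^ k) where

    balanced : Balanced k c []
    balanced = trans (ℕP.+-identityʳ (∑ c)) ∑c≡2^k

    knuthYao : Tree n
    knuthYao = sole (forest k c []) (length-forest k c [] balanced)

    forest≡knuthYao : forest k c [] ≡ knuthYao ∷ []
    forest≡knuthYao = sole-∷ (forest k c []) (length-forest k c [] balanced)

    treeCount-knuthYao : ∀ i t → treeCount knuthYao i t ≡ forestCount (forest k c []) i t
    treeCount-knuthYao i t = trans (sym (ℕP.+-identityʳ _)) (cong (λ σs → forestCount σs i t) (sym forest≡knuthYao))

    height-knuthYao : height knuthYao ≤ k
    height-knuthYao = subst (height knuthYao ≤_) (ℕP.+-identityʳ k)
      (All.head (subst (All (λ σ → height σ ≤ k + 0)) forest≡knuthYao (height-forest k c [] [])))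

    treeCount-knuthYao-beyond : ∀ i u → treeCount knuthYao i (k + u) ≡ c i * 2 ^ u
    treeCount-knuthYao-beyond i u =
      trans (treeCount-knuthYao i (k + u)) (trans (forestCount-forest k c [] balanced i u) (ℕP.+-identityʳ _))

    treeCount-knuthYao-k : ∀ i → treeCount knuthYao i k ≡ c i
    treeCount-knuthYao-k i = trans (cong (treeCount knuthYao i) (sym (ℕP.+-identityʳ k)))
      (trans (treeCount-knuthYao-beyond i 0) (ℕP.*-identityʳ (c i)))

    treeCount-knuthYao-bounded : ∀ i t → treeCount knuthYao i t * 2 ^ k ≤ c i * 2 ^ t
    treeCount-knuthYao-bounded i t with ℕP.≤-total t k
    ... | inj₁ t≤k = begin
      treeCount knuthYao i t * 2 ^ k              ≡⟨ *-2^-split (treeCount knuthYao i t) t≤k ⟩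
      treeCount knuthYao i t * 2 ^ (k ∸ t) * 2 ^ t  ≤⟨ ℕP.*-monoˡ-≤ (2 ^ t) (treeCount-*2^-≤ knuthYao i t (k ∸ t)) ⟩
      treeCount knuthYao i (t + (k ∸ t)) * 2 ^ t    ≡⟨ cong (λ s → treeCount knuthYao i s * 2 ^ t) (ℕP.m+[n∸m]≡n t≤k) ⟩
      treeCount knuthYao i k * 2 ^ t              ≡⟨ cong (_* 2 ^ t) (treeCount-knuthYao-k i) ⟩
      c i * 2 ^ t ∎
      where open ℕP.≤-Reasoning
    ... | inj₂ k≤t = ℕP.≤-reflexive (begin-equality
      treeCount knuthYao i t * 2 ^ k             ≡⟨ cong (λ s → treeCount knuthYao i s * 2 ^ k) (sym (ℕP.m+[n∸m]≡n k≤t)) ⟩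
      treeCount knuthYao i (k + (t ∸ k)) * 2 ^ k  ≡⟨ cong (_* 2 ^ k) (treeCount-knuthYao-beyond i (t ∸ k)) ⟩
      c i * 2 ^ (t ∸ k) * 2 ^ k                  ≡⟨ sym (*-2^-split (c i) k≤t) ⟩
      c i * 2 ^ t ∎)
      where open ℕP.≤-Reasoning

    treeCount-knuthYao-maximal : ∀ i t {C} → C * 2 ^ k ≤ c i * 2 ^ t → C ≤ treeCount knuthYao i t
    treeCount-knuthYao-maximal i t {C} le with ℕP.≤-total t k
    ... | inj₁ t≤k = subst (C ≤_) (sym (treeCount-knuthYao i t)) (forestCount-forest-maximal k c [] balanced i t≤k
      (ℕP.*-cancelʳ-≤ (C * 2 ^ (k ∸ t)) (c i) (2 ^ t) {{ℕP.m^n≢0 2 t}} (subst (_≤ c i * 2 ^ t) (*-2^-split C t≤k) le)))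
    ... | inj₂ k≤t = subst (C ≤_) (sym count≡)
      (ℕP.*-cancelʳ-≤ C (c i * 2 ^ (t ∸ k)) (2 ^ k) {{ℕP.m^n≢0 2 k}} (subst (C * 2 ^ k ≤_) (*-2^-split (c i) k≤t) le))
      where
      count≡ : treeCount knuthYao i t ≡ c i * 2 ^ (t ∸ k)
      count≡ = trans (cong (treeCount knuthYao i) (sym (ℕP.m+[n∸m]≡n k≤t))) (treeCount-knuthYao-beyond i (t ∸ k))

module OptimalSampler {n k} (T̃ : DDG n) (halts : HaltsWithin T̃ k) where

  c : Fin n → ℕ
  c i = haltCount T̃ i k

  open KnuthYao.OfCounts k c (∑haltCount≡2^ T̃ halts)
  open Compile knuthYao k

  sampler : DDG n
  sampler = compile

  sampler-precision : Precision sampler k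
  sampler-precision = precision height-knuthYao

  haltCount-sampler : ∀ i t → haltCount sampler i t ≡ treeCount knuthYao i t
  haltCount-sampler = haltCount-compile height-knuthYao

  haltProb-sampler-k : ∀ i → haltProb sampler k i ≡ dyadic (c i) k
  haltProb-sampler-k i = cong (λ a → dyadic a k) (trans (haltCount-sampler i k) (treeCount-knuthYao-k i))

  module _ {p̃} (out : OutputDist T̃ p̃) where

    p̃≡ : ∀ i → p̃ i ≡ dyadic (c i) k
    p̃≡ i = sym (haltProb≡outputDist T̃ halts out i)

    sampler-output : OutputDist sampler p̃
    sampler-output = (λ i → IsSup-attained k (bound i) (trans (haltProb-sampler-k i) (sym (p̃≡ i)))) , proj₂ out
      where
      bound : ∀ i t → haltProb sampler t i ℚ.≤ p̃ i
      bound i t = subst₂ ℚ._≤_ (cong (λ a → dyadic a t) (sym (haltCount-sampler i t))) (sym (p̃≡ i))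
        (dyadic-≤-cross {treeCount knuthYao i t} {c i} k t (treeCount-knuthYao-bounded i t))

  sampler-entropyOptimal : EntropyOptimal sampler
  sampler-entropyOptimal T′ q out out′ =
    pendingCount-mono⇒ExpBitsLe λ t → pendingCount-anti T′ sampler t λ i →
      subst (haltCount T′ i t ≤_) (sym (haltCount-sampler i t)) (treeCount-knuthYao-maximal i t (haltCount′-bounded i t))
    where
    q≡ : ∀ i → q i ≡ dyadic (c i) k
    q≡ i = trans (sym (haltProb≡outputDist sampler (compile-halts height-knuthYao) out i)) (haltProb-sampler-k i)
    haltCount′-bounded : ∀ i t → haltCount T′ i t * 2 ^ k ≤ c i * 2 ^ t
    haltCount′-bounded i t =
      dyadic-≤-cross⁻ {haltCount T′ i t} {c i} k t (subst (haltProb T′ t i ℚ.≤_) (q≡ i) (proj₁ (proj₁ out′ i) t))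

proposition2p16 : {n : ℕ} (Target V : Set) (_≼_ : V → V → Set)
    (Δ : Target → (Fin n → ℚ) → V) (p : Target) (k : ℕ) → 1 ≤ k →
    (T̂ : DDG n) (p̂ : Fin n → ℚ) →
    EntropyOptimal T̂ → Precision T̂ k → OutputDist T̂ p̂ →
    ((T : DDG n) (q : Fin n → ℚ) → EntropyOptimal T → Precision T k → OutputDist T q → Δ p p̂ ≼ Δ p q) →
    (T̃ : DDG n) (p̃ : Fin n → ℚ) → HaltsWithin T̃ k → OutputDist T̃ p̃ →
    Δ p p̂ ≼ Δ p p̃
proposition2p16 Target V _≼_ Δ p k _ T̂ p̂ _ _ _ closest T̃ p̃ halts out =
  closest sampler p̃ sampler-entropyOptimal sampler-precision (sampler-output out)
  where open OptimalSampler T̃ halts
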